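{- Let $G$ be a neighborhood-prime graph with $|V(G)|=n$, and let $v\in V(G)$ with $\deg(v)>1$. Then the graph $G'$ obtained from $G$ by adding a new vertex $v'$ and the edge $vv'$ is neighborhood-prime.
   Context: A neighborhood-prime labeling of a simple graph $G$ with $N$ vertices is a bijection $f:V(G)\to\{1,\ldots,N\}$ such that for every vertex $v$ with $\deg(v)>1$, $\gcd\{f(u):u\in N(v)\}=1$, where $N(v)$ is the set of vertices adjacent to $v$; a graph admitting one is neighborhood-prime. -}

module Defs where

open import Data.Nat using (ℕ; suc; zero; _<_)
open import Data.Nat.GCD using (gcd)
open import Data.Bool using (Bool; true; false; T; _∨_)
open import Data.Bool.Properties using (T?)
open import Data.Fin using (Fin; toℕ; fromℕ; inject₁; zero; suc)
open import Data.List using (List; map; foldr; filter; length; allFin)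
open import Data.Maybe using (Maybe; just; nothing)
open import Function.Bundles using (_↔_; Inverse)
open import Relation.Binary.PropositionalEquality using (_≡_)
open import Relation.Nullary.Decidable using (⌊_⌋)
open import Data.Fin.Properties using () renaming (_≟_ to _≟F_)

record Graph (n : ℕ) : Set where
  field
    adj    : Fin n → Fin n → Bool
    sym    : ∀ u v → adj u v ≡ adj v u
    irrefl : ∀ v → adj v v ≡ false
open Graph public

nbhd : ∀ {n} → Graph n → Fin n → List (Fin n)
nbhd G v = filter (λ u → T? (adj G v u)) (allFin _)

deg : ∀ {n} → Graph n → Fin n → ℕ
deg G v = length (nbhd G v)

gcdList : List ℕ → ℕ
gcdList = foldr gcd 0

-- Labels {1,…,N} are encoded as Fin N: i : Fin N stands for toℕ i + 1.
label : ∀ {n} → Fin n → ℕ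
label i = suc (toℕ i)

record NPLabeling {n : ℕ} (G : Graph n) : Set where
  field
    f     : Fin n ↔ Fin n
    prime : ∀ v → 1 < deg G v →
            gcdList (map (λ u → label (Inverse.to f u)) (nbhd G v)) ≡ 1

NeighborhoodPrime : ∀ {n} → Graph n → Set
NeighborhoodPrime G = NPLabeling G

-- Old vertices of Fin (suc n) are inject₁ u; the new vertex is fromℕ n.
old? : ∀ {n} → Fin (suc n) → Maybe (Fin n)
old? {zero}  zero    = nothing
old? {suc n} zero    = just zero
old? {suc n} (suc i) = Data.Maybe.map suc (old? i)

adjPend : ∀ {n} → Graph n → Fin n → Fin (suc n) → Fin (suc n) → Bool
adjPend G v a b with old? a | old? b
... | just x  | just y  = adj G x y
... | just x  | nothing = ⌊ x ≟F v ⌋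
... | nothing | just y  = ⌊ y ≟F v ⌋
... | nothing | nothing = false

private
  old?-sym : ∀ {n} (G : Graph n) v a b → adjPend G v a b ≡ adjPend G v b a
  old?-sym G v a b with old? a | old? b
  ... | just x  | just y  = sym G x y
  ... | just x  | nothing = _≡_.refl
  ... | nothing | just y  = _≡_.refl
  ... | nothing | nothing = _≡_.refl

  old?-irr : ∀ {n} (G : Graph n) v a → adjPend G v a a ≡ false
  old?-irr G v a with old? a
  ... | just x  = irrefl G x
  ... | nothing = _≡_.refl

addPendant : ∀ {n} → Graph n → Fin n → Graph (suc n)
addPendant G v = record { adj = adjPend G v ; sym = old?-sym G v ; irrefl = old?-irr G v }

module Submission where

-- Give the pendant vertex the largest label n + 1 and keep all other labels.
-- The pendant has degree 1, and every old vertex other than v keeps its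
-- neighbourhood, hence its degree and its gcd.  The neighbourhood of v only
-- gains a label, and adding elements to a list of gcd 1 keeps the gcd 1;
-- the gcd condition at v itself comes from deg v > 1 in G.

open import Defs hiding (sym)
open import Data.Nat using (ℕ; zero; suc; _<_; _≤_; z≤n; s≤s)
open import Data.Nat.Properties using (<⇒≱)
open import Data.Nat.GCD using (gcd; gcd[m,n]∣m; gcd[m,n]∣n; gcd-greatest)
open import Data.Nat.Divisibility using (_∣_; ∣-trans; _∣0; ∣1⇒≡1)
open import Data.Bool using (Bool; T)
open import Data.Empty using (⊥-elim)
open import Data.Bool.Properties using (T?)
open import Data.Fin using (Fin; zero; suc; fromℕ; inject₁; punchIn)
open import Data.Fin.Properties using (toℕ-inject₁; _≟_)
open import Data.Fin.Relation.Unary.Top using (view; ‵fromℕ; ‵inject₁)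
open import Data.Fin.Permutation using (Permutation′; insert; insert-punchIn; _⟨$⟩ʳ_)
open import Data.List using (List; []; _∷_; _++_; [_]; _∷ʳ_; map; tabulate; foldr; filter; length; allFin)
open import Data.List.Properties using (filter-++; filter-≐; filter-reject; foldr-++; map-++; map-∘; map-cong; map-tabulate; length-map; ++-identityʳ)
open import Data.List.Relation.Unary.All as All using (All; _∷_)
open import Data.List.Relation.Unary.All.Properties using (all-filter)
open import Data.List.Relation.Unary.AllPairs using (_∷_)
open import Data.List.Relation.Unary.Unique.Propositional using (Unique)
open import Data.List.Relation.Unary.Unique.Propositional.Properties using (filter⁺; allFin⁺)
open import Data.Maybe using (just; nothing)
open import Data.Product using (_,_)
open import Function using (_∘_; id)
open import Level using (Level)
open import Relation.Binary.PropositionalEquality using (_≡_; _≢_; refl; sym; trans; cong; subst; subst₂; module ≡-Reasoning)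
open import Relation.Nullary using (¬_; contradiction; yes; no)
open import Relation.Nullary.Decidable using (⌊_⌋; toWitness)
open import Relation.Unary using (Pred; Decidable)

open ≡-Reasoning

private
  variable
    n : ℕ

module _ {A B : Set} {p : Level} {P : Pred B p} (P? : Decidable P) (f : A → B) where

  filter-map : ∀ xs → filter P? (map f xs) ≡ map f (filter (P? ∘ f) xs)
  filter-map [] = refl
  filter-map (x ∷ xs) with P? (f x)
  ... | yes _ = cong (f x ∷_) (filter-map xs)
  ... | no _  = filter-map xs

filter-T-cong : ∀ {A : Set} {p q : A → Bool} → (∀ x → p x ≡ q x) →
                ∀ xs → filter (T? ∘ p) xs ≡ filter (T? ∘ q) xs
filter-T-cong p≗q = filter-≐ _ _ ((λ {x} → subst T (p≗q x)) , (λ {x} → subst T (sym (p≗q x))))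

tabulate-∷ʳ : ∀ {A : Set} (g : Fin (suc n) → A) → tabulate g ≡ tabulate (g ∘ inject₁) ∷ʳ g (fromℕ n)
tabulate-∷ʳ {n = zero}  g = refl
tabulate-∷ʳ {n = suc n}  g = cong (g zero ∷_) (tabulate-∷ʳ (g ∘ suc))

allFin-∷ʳ : ∀ n → allFin (suc n) ≡ map inject₁ (allFin n) ∷ʳ fromℕ n
allFin-∷ʳ n = trans (tabulate-∷ʳ id) (cong (_∷ʳ fromℕ n) (sym (map-tabulate id inject₁)))

unique-constant⇒length≤1 : ∀ {A : Set} {x : A} {xs} → Unique xs → All (_≡ x) xs → length xs ≤ 1
unique-constant⇒length≤1 {xs = []}         _                 _              = z≤n
unique-constant⇒length≤1 {xs = _ ∷ []}     _                 _              = s≤s z≤n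
unique-constant⇒length≤1 {xs = _ ∷ _ ∷ _} ((y≢z ∷ _) ∷ _) (y≡x ∷ z≡x ∷ _) = contradiction (trans y≡x (sym z≡x)) y≢z

foldr-gcd-∣-gcdList : ∀ z xs → foldr gcd z xs ∣ gcdList xs
foldr-gcd-∣-gcdList z []       = z ∣0
foldr-gcd-∣-gcdList z (x ∷ xs) = gcd-greatest (gcd[m,n]∣m x _) (∣-trans (gcd[m,n]∣n x _) (foldr-gcd-∣-gcdList z xs))

gcdList-++-≡1 : ∀ xs ys → gcdList xs ≡ 1 → gcdList (xs ++ ys) ≡ 1
gcdList-++-≡1 xs ys gcd≡1 = ∣1⇒≡1 (subst₂ _∣_ (sym (foldr-++ gcd 0 xs ys)) gcd≡1 (foldr-gcd-∣-gcdList (gcdList ys) xs))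

adj⇒≡⇒deg≤1 : ∀ (G : Graph n) a b → (∀ u → T (adj G a u) → u ≡ b) → deg G a ≤ 1
adj⇒≡⇒deg≤1 {n} G a b adj⇒≡ = unique-constant⇒length≤1
  (filter⁺ (T? ∘ adj G a) (allFin⁺ n))
  (All.map (adj⇒≡ _) (all-filter (T? ∘ adj G a) (allFin n)))

old?-inject₁ : ∀ (i : Fin n) → old? (inject₁ i) ≡ just i
old?-inject₁ {suc n} zero    = refl
old?-inject₁ {suc n} (suc i) rewrite old?-inject₁ i = refl

old?-fromℕ : ∀ n → old? (fromℕ n) ≡ nothing
old?-fromℕ zero    = refl
old?-fromℕ (suc n) rewrite old?-fromℕ n = refl

module _ (G : Graph n) (v : Fin n) where

  private
    G⁺ : Graph (suc n)
    G⁺ = addPendant G v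

  adjPend-inject₁-inject₁ : ∀ w u → adjPend G v (inject₁ w) (inject₁ u) ≡ adj G w u
  adjPend-inject₁-inject₁ w u rewrite old?-inject₁ w | old?-inject₁ u = refl

  adjPend-inject₁-fromℕ : ∀ w → adjPend G v (inject₁ w) (fromℕ n) ≡ ⌊ w ≟ v ⌋
  adjPend-inject₁-fromℕ w rewrite old?-inject₁ w | old?-fromℕ n = refl

  nbhd-addPendant-inject₁ : ∀ w → nbhd G⁺ (inject₁ w) ≡
    map inject₁ (nbhd G w) ++ filter (T? ∘ adjPend G v (inject₁ w)) [ fromℕ n ]
  nbhd-addPendant-inject₁ w = begin
    filter (T? ∘ p) (allFin (suc n))
      ≡⟨ cong (filter (T? ∘ p)) (allFin-∷ʳ n) ⟩
    filter (T? ∘ p) (map inject₁ (allFin n) ++ [ fromℕ n ])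
      ≡⟨ filter-++ (T? ∘ p) (map inject₁ (allFin n)) [ fromℕ n ] ⟩
    filter (T? ∘ p) (map inject₁ (allFin n)) ++ filter (T? ∘ p) [ fromℕ n ]
      ≡⟨ cong (_++ filter (T? ∘ p) [ fromℕ n ]) (filter-map (T? ∘ p) inject₁ (allFin n)) ⟩
    map inject₁ (filter (T? ∘ p ∘ inject₁) (allFin n)) ++ filter (T? ∘ p) [ fromℕ n ]
      ≡⟨ cong (λ xs → map inject₁ xs ++ filter (T? ∘ p) [ fromℕ n ]) (filter-T-cong (adjPend-inject₁-inject₁ w) (allFin n)) ⟩
    map inject₁ (nbhd G w) ++ filter (T? ∘ p) [ fromℕ n ] ∎
    where
    p : Fin (suc n) → Bool
    p = adjPend G v (inject₁ w)

  deg-addPendant-inject₁ : ∀ w → w ≢ v → deg G⁺ (inject₁ w) ≡ deg G w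
  deg-addPendant-inject₁ w w≢v = begin
    length (nbhd G⁺ (inject₁ w))
      ≡⟨ cong length (nbhd-addPendant-inject₁ w) ⟩
    length (map inject₁ (nbhd G w) ++ filter (T? ∘ adjPend G v (inject₁ w)) [ fromℕ n ])
      ≡⟨ cong (λ ys → length (map inject₁ (nbhd G w) ++ ys)) (filter-reject (T? ∘ adjPend G v (inject₁ w)) ¬adj) ⟩
    length (map inject₁ (nbhd G w) ++ [])
      ≡⟨ cong length (++-identityʳ (map inject₁ (nbhd G w))) ⟩
    length (map inject₁ (nbhd G w))
      ≡⟨ length-map inject₁ (nbhd G w) ⟩
    deg G w ∎
    where
    ¬adj : ¬ T (adjPend G v (inject₁ w) (fromℕ n))
    ¬adj = w≢v ∘ toWitness ∘ subst T (adjPend-inject₁-fromℕ w)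

  1<deg-addPendant-inject₁ : 1 < deg G v → ∀ w → 1 < deg G⁺ (inject₁ w) → 1 < deg G w
  1<deg-addPendant-inject₁ 1<deg[v] w 1<deg⁺[w] with w ≟ v
  ... | yes refl = 1<deg[v]
  ... | no w≢v   = subst (1 <_) (deg-addPendant-inject₁ w w≢v) 1<deg⁺[w]

  deg-addPendant-fromℕ≤1 : deg G⁺ (fromℕ n) ≤ 1
  deg-addPendant-fromℕ≤1 = adj⇒≡⇒deg≤1 G⁺ (fromℕ n) (inject₁ v) adj⇒≡
    where
    adj⇒≡ : ∀ u → T (adj G⁺ (fromℕ n) u) → u ≡ inject₁ v
    adj⇒≡ u adj[u] with view u
    ... | ‵fromℕ     = ⊥-elim (subst T (irrefl G⁺ (fromℕ n)) adj[u])
    ... | ‵inject₁ w =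
      cong inject₁ (toWitness (subst T (trans (Graph.sym G⁺ (fromℕ n) (inject₁ w)) (adjPend-inject₁-fromℕ w)) adj[u]))

punchIn-fromℕ : ∀ (i : Fin n) → punchIn (fromℕ n) i ≡ inject₁ i
punchIn-fromℕ zero    = refl
punchIn-fromℕ (suc i) = cong suc (punchIn-fromℕ i)

insert-fromℕ-inject₁ : ∀ (π : Permutation′ n) i →
  insert (fromℕ n) (fromℕ n) π ⟨$⟩ʳ inject₁ i ≡ inject₁ (π ⟨$⟩ʳ i)
insert-fromℕ-inject₁ {n} π i = begin
  insert (fromℕ n) (fromℕ n) π ⟨$⟩ʳ inject₁ i          ≡⟨ cong (insert (fromℕ n) (fromℕ n) π ⟨$⟩ʳ_) (sym (punchIn-fromℕ i)) ⟩
  insert (fromℕ n) (fromℕ n) π ⟨$⟩ʳ punchIn (fromℕ n) i ≡⟨ insert-punchIn (fromℕ n) (fromℕ n) π i ⟩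
  punchIn (fromℕ n) (π ⟨$⟩ʳ i)                         ≡⟨ punchIn-fromℕ (π ⟨$⟩ʳ i) ⟩
  inject₁ (π ⟨$⟩ʳ i)                                   ∎

labels : Permutation′ n → List (Fin n) → List ℕ
labels π = map (label ∘ (π ⟨$⟩ʳ_))

labels-insert-fromℕ : ∀ (π : Permutation′ n) xs →
  labels (insert (fromℕ n) (fromℕ n) π) (map inject₁ xs) ≡ labels π xs
labels-insert-fromℕ π xs = trans (sym (map-∘ xs)) (map-cong label-inject₁ xs)
  where
  label-inject₁ : ∀ i → label (insert (fromℕ _) (fromℕ _) π ⟨$⟩ʳ inject₁ i) ≡ label (π ⟨$⟩ʳ i)
  label-inject₁ i = trans (cong label (insert-fromℕ-inject₁ π i)) (cong suc (toℕ-inject₁ (π ⟨$⟩ʳ i)))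

mainTheorem10 : (n : ℕ) (G : Graph n) (v : Fin n) →
    NeighborhoodPrime G → 1 < deg G v → NeighborhoodPrime (addPendant G v)
mainTheorem10 n G v npl 1<deg[v] = record { f = π⁺ ; prime = prime⁺ }
  where
  open NPLabeling npl renaming (f to π)

  π⁺ : Permutation′ (suc n)
  π⁺ = insert (fromℕ n) (fromℕ n) π

  prime⁺ : ∀ a → 1 < deg (addPendant G v) a → gcdList (labels π⁺ (nbhd (addPendant G v) a)) ≡ 1
  prime⁺ a 1<deg⁺[a] with view a
  ... | ‵fromℕ = contradiction (deg-addPendant-fromℕ≤1 G v) (<⇒≱ 1<deg⁺[a])
  ... | ‵inject₁ w = begin
    gcdList (labels π⁺ (nbhd (addPendant G v) (inject₁ w)))
      ≡⟨ cong (gcdList ∘ labels π⁺) (nbhd-addPendant-inject₁ G v w) ⟩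
    gcdList (labels π⁺ (map inject₁ (nbhd G w) ++ E))
      ≡⟨ cong gcdList (map-++ (label ∘ (π⁺ ⟨$⟩ʳ_)) (map inject₁ (nbhd G w)) E) ⟩
    gcdList (labels π⁺ (map inject₁ (nbhd G w)) ++ labels π⁺ E)
      ≡⟨ cong (λ xs → gcdList (xs ++ labels π⁺ E)) (labels-insert-fromℕ π (nbhd G w)) ⟩
    gcdList (labels π (nbhd G w) ++ labels π⁺ E)
      ≡⟨ gcdList-++-≡1 (labels π (nbhd G w)) (labels π⁺ E) (prime w (1<deg-addPendant-inject₁ G v 1<deg[v] w 1<deg⁺[a])) ⟩
    1 ∎
    where
    E : List (Fin (suc n))
    E = filter (T? ∘ adjPend G v (inject₁ w)) [ fromℕ n ]
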